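{- Let $k \in \mathbb{N}_0$ and let $G$ be a graph. Then $G \in F(\chi,k)$ if and only if the following three conditions hold: (1) $G$ has a unique dominating vertex $v$; (2) in every optimal (proper, minimum-color) coloring of $G-v$, each color class consists of at least two vertices; (3) $\Delta(G)=\chi(G)+k$.
   Context: All graphs are finite and simple. $\Delta(H)$ denotes the maximum degree, $\chi(H)$ the chromatic number of $H$. A vertex is dominating if it is adjacent to all other vertices. For $k\in\mathbb{N}_0$, $\varUpsilon_k$ is the class of graphs $G$ such that every induced subgraph $H$ of $G$ (including $G$ itself) satisfies $\Delta(H)\le \chi(H)+k-1$. $F(\chi,k)$ denotes the set of minimal forbidden induced subgraphs of $\varUpsilon_k$: $F\in F(\chi,k)$ iff $F\notin\varUpsilon_k$ and every proper induced subgraph of $F$ lies in $\varUpsilon_k$ (graphs considered up to isomorphism). -}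

module Defs where

open import Data.Nat using (ℕ; zero; suc; _+_; _≤_; _<_; _⊔_; pred)
open import Data.Fin using (Fin; zero; suc; punchIn)
open import Data.Bool using (Bool; true; false; if_then_else_)
open import Data.List using (List; map; foldr; allFin)
open import Data.Nat.ListAction using (sum)
open import Data.Product using (Σ; ∃; ∃-syntax; _×_; _,_)
open import Relation.Binary.PropositionalEquality using (_≡_; _≢_)
open import Relation.Nullary using (¬_)
open import Function.Definitions using (Injective)

record Graph (n : ℕ) : Set where
  field
    adj    : Fin n → Fin n → Bool
    sym    : ∀ i j → adj i j ≡ adj j i
    irrefl : ∀ i → adj i i ≡ false
open Graph public

-- Induced subgraph along a map e : Fin m → Fin n (intended injective).
induce : ∀ {m n} → Graph n → (Fin m → Fin n) → Graph m
induce G e = record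
  { adj    = λ i j → adj G (e i) (e j)
  ; sym    = λ i j → sym G (e i) (e j)
  ; irrefl = λ i → irrefl G (e i)
  }

delete : ∀ {n} → Graph n → Fin n → Graph (pred n)
delete {suc m} G v = induce G (punchIn v)

-- degree of a vertex and maximum degree Δ (Δ of the empty graph is 0)
deg : ∀ {n} → Graph n → Fin n → ℕ
deg {n} G i = sum (map (λ j → if adj G i j then 1 else 0) (allFin n))

maxDeg : ∀ {n} → Graph n → ℕ
maxDeg {n} G = foldr _⊔_ 0 (map (deg G) (allFin n))

ProperColoring : ∀ {n c} → Graph n → (Fin n → Fin c) → Set
ProperColoring G f = ∀ i j → adj G i j ≡ true → f i ≢ f j

Colorable : ∀ {n} → Graph n → ℕ → Set
Colorable {n} G c = Σ (Fin n → Fin c) (ProperColoring G)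

IsChromaticNumber : ∀ {n} → Graph n → ℕ → Set
IsChromaticNumber G c = Colorable G c × (∀ c' → c' < c → ¬ Colorable G c')

Dominating : ∀ {n} → Graph n → Fin n → Set
Dominating G v = ∀ u → u ≢ v → adj G v u ≡ true

-- Δ(H) ≤ χ(H) + k - 1  (stated over ℕ as Δ(H) + 1 ≤ χ(H) + k)
DegBound : ∀ {m} → ℕ → Graph m → Set
DegBound k H = ∀ c → IsChromaticNumber H c → maxDeg H + 1 ≤ c + k

InUpsilon : ∀ {n} → ℕ → Graph n → Set
InUpsilon {n} k G =
  ∀ m (e : Fin m → Fin n) → Injective _≡_ _≡_ e → 0 < m → DegBound k (induce G e)

InForbidden : ∀ {n} → ℕ → Graph n → Set
InForbidden {n} k G =
  ¬ InUpsilon k G ×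
  (∀ m (e : Fin m → Fin n) → Injective _≡_ _≡_ e → m < n → InUpsilon k (induce G e))

OptimalClassesAtLeastTwo : ∀ {m} → Graph m → Set
OptimalClassesAtLeastTwo {m} H =
  ∀ c → IsChromaticNumber H c →
  ∀ (f : Fin m → Fin c) → ProperColoring H f →
  ∀ (a : Fin c) → ∃[ i ] ∃[ j ] (i ≢ j × f i ≡ a × f j ≡ a)

DeltaEqChiPlus : ∀ {n} → ℕ → Graph n → Set
DeltaEqChiPlus k G = ∀ c → IsChromaticNumber G c → maxDeg G ≡ c + k

-- A graph G ∈ F(χ,k) violates the bound while every G - x obeys
-- it.  For a vertex u of maximum degree, deg(u) ≥ χ(G) + k exceeds the degree
-- of u in any G - x, so u is adjacent to every x, and χ(G - x) = χ(G) for
-- x ≠ u.  Deleting a dominating vertex, or a vertex alone in its colour class,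
-- saves a colour; hence u is the only dominating vertex, no optimal colouring
-- of G - u has a singleton class, and Δ(G) = χ(G) + k.
--
-- Conditions (1)-(3) give |G| = χ(G - v) + k + 2 and make
-- H = G - v vertex-critical.  Extending colourings one vertex at a time, an
-- induced subgraph of H missing a vertex has at most χ + k vertices; this gives
-- the bound for every proper induced subgraph of G except H itself, where the
-- uniqueness of v provides every vertex with a non-neighbour.

module Submission where

open import Defs renaming (sym to adj-sym)
open import Data.Nat
  using (ℕ; zero; suc; _+_; _∸_; _≤_; _<_; _⊔_; z≤n; s≤s; s≤s⁻¹; _≤?_; _<?_)
open import Data.Nat.Properties
  using (≤-refl; ≤-reflexive; ≤-trans; ≤-antisym; ≤-<-trans; <-≤-trans; <-irrefl; <⇒≱; ≮⇒≥; ≰⇒>;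
         n<1+n; m<1+n⇒m<n∨m≡n; +-comm; +-assoc; +-suc; +-identityʳ; +-mono-≤; +-monoˡ-≤;
         +-monoʳ-≤; +-cancelˡ-≤; +-cancelʳ-≤; m≤m+n; +-∸-assoc; m∸n+n≡m;
         m≤n⇒m∸n≡0; m+1+n≰m; ⊔-lub; ⊔-sel; m≤m⊔n; m≤n⊔m; ⊔-identityʳ;
         +-commutativeSemigroup; +-0-commutativeMonoid; module ≤-Reasoning)
  renaming (suc-injective to 1+-injective)
open import Data.Fin using (Fin; zero; suc; punchIn; punchOut; _≟_; fromℕ; inject₁; inject≤)
open import Data.Fin.Properties
  using (suc-injective; punchIn-punchOut; punchInᵢ≢i; punchIn-injective; punchOut-injective;
         fromℕ≢inject₁; inject₁-injective; inject≤-injective; any?; all?; ¬∀⟶∃¬; injective⇒≤)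
open import Data.Vec.Functional using (insertAt; _∷_)
open import Data.Vec.Functional.Properties using (insertAt-lookup; insertAt-punchIn)
open import Data.Bool using (Bool; true; false; if_then_else_)
import Data.Bool as Bool
open import Data.Bool.Properties using (¬-not)
open import Data.List using (map; foldr; allFin; tabulate)
open import Data.List.Properties using (map-tabulate)
import Data.Nat.ListAction as List
open import Algebra.Properties.CommutativeSemigroup +-commutativeSemigroup using (x∙yz≈y∙xz)
open import Algebra.Properties.CommutativeMonoid.Sum +-0-commutativeMonoid
  using (sum-remove; sum-cong-≗) renaming (sum to ∑)
open import Data.Product using (Σ; ∃; _×_; _,_; proj₁; proj₂; map₂)
open import Data.Sum using (_⊎_; inj₁; inj₂; [_,_]′)
open import Relation.Binary.PropositionalEquality
open import Relation.Nullary using (¬_; Dec; yes; no; ¬?; contradiction)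
open import Relation.Nullary.Decidable using (map′; _×-dec_; _→-dec_)
open import Function using (_∘_)
open import Function.Definitions using (Injective)
open import Function.Bundles using (_⇔_; mk⇔)

-- An injection into Fin (suc n) that misses x factors injectively through
-- punchIn x; this is how induced subgraphs avoiding x live inside G - x.
factor : ∀ {m n} (x : Fin (suc n)) (e : Fin m → Fin (suc n)) →
         Injective _≡_ _≡_ e → (∀ j → e j ≢ x) →
         Σ (Fin m → Fin n) λ e′ → Injective _≡_ _≡_ e′ × (∀ j → punchIn x (e′ j) ≡ e j)
factor x e inj misses = e′ , e′-injective , λ j → punchIn-punchOut (x≢e j)
  where
  x≢e : ∀ j → x ≢ e j
  x≢e j = misses j ∘ sym
  e′ : _ → _
  e′ j = punchOut (x≢e j)
  e′-injective : Injective _≡_ _≡_ e′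
  e′-injective eq = inj (punchOut-injective (x≢e _) (x≢e _) eq)

missed-or-onto : ∀ {m n} (e : Fin m → Fin n) →
                 (∃ λ x → ∀ j → e j ≢ x) ⊎ (∀ x → ∃ λ j → e j ≡ x)
missed-or-onto {n = n} e = decide (all? hit?)
  where
  hit? : ∀ x → Dec (∃ λ j → e j ≡ x)
  hit? x = any? (λ j → e j ≟ x)
  decide : Dec (∀ x → ∃ λ j → e j ≡ x) →
           (∃ λ x → ∀ j → e j ≢ x) ⊎ (∀ x → ∃ λ j → e j ≡ x)
  decide (yes onto) = inj₂ onto
  decide (no ¬onto) = inj₁ (map₂ (λ ¬hit j ej≡x → ¬hit (j , ej≡x)) (¬∀⟶∃¬ n _ hit? ¬onto))

-- An onto map Fin m → Fin n forces n ≤ m (its section is injective).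
onto⇒≥ : ∀ {m n} (e : Fin m → Fin n) → (∀ x → ∃ λ j → e j ≡ x) → n ≤ m
onto⇒≥ e onto = injective⇒≤ {f = proj₁ ∘ onto} section-injective
  where
  section-injective : Injective _≡_ _≡_ (proj₁ ∘ onto)
  section-injective {x} {y} eq =
    trans (sym (proj₂ (onto x))) (trans (cong e eq) (proj₂ (onto y)))

missed-point : ∀ {m n} (e : Fin m → Fin n) → m < n → ∃ λ x → ∀ j → e j ≢ x
missed-point e m<n with missed-or-onto e
... | inj₁ missed = missed
... | inj₂ onto   = contradiction (onto⇒≥ e onto) (<⇒≱ m<n)

⟦_⟧ : Bool → ℕ
⟦ b ⟧ = if b then 1 else 0

list-∑ : ∀ {n} (h : Fin n → ℕ) → List.sum (map h (allFin n)) ≡ ∑ h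
list-∑ h = trans (cong List.sum (map-tabulate (λ i → i) h)) (tabulated h)
  where
  tabulated : ∀ {n} (h : Fin n → ℕ) → List.sum (tabulate h) ≡ ∑ h
  tabulated {zero}  h = refl
  tabulated {suc n} h = cong (h zero +_) (tabulated (h ∘ suc))

deg-∑ : ∀ {n} (G : Graph n) i → deg G i ≡ ∑ (λ j → ⟦ adj G i j ⟧)
deg-∑ G i = list-∑ (λ j → ⟦ adj G i j ⟧)

⟦⟧≤1 : ∀ b → ⟦ b ⟧ ≤ 1
⟦⟧≤1 true  = ≤-refl
⟦⟧≤1 false = z≤n

∑-≤1 : ∀ {n} (h : Fin n → ℕ) → (∀ j → h j ≤ 1) → ∑ h ≤ n
∑-≤1 {zero}  h h≤1 = z≤n
∑-≤1 {suc n} h h≤1 = +-mono-≤ (h≤1 zero) (∑-≤1 (h ∘ suc) (h≤1 ∘ suc))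

∑-ones : ∀ {n} (h : Fin n → ℕ) → (∀ j → h j ≡ 1) → ∑ h ≡ n
∑-ones {zero}  h h≡1 = refl
∑-ones {suc n} h h≡1 = cong₂ _+_ (h≡1 zero) (∑-ones (h ∘ suc) (h≡1 ∘ suc))

-- Summing along an injection picks each term at most once.
∑-injective : ∀ {m n} (h : Fin n → ℕ) (e : Fin m → Fin n) →
              Injective _≡_ _≡_ e → ∑ (h ∘ e) ≤ ∑ h
∑-injective {zero}          h e inj = z≤n
∑-injective {suc m} {zero}  h e inj with e zero
... | ()
∑-injective {suc m} {suc n} h e inj = begin
  h x + ∑ (h ∘ e ∘ suc)          ≡⟨ cong (h x +_) (sum-cong-≗ (cong h ∘ sym ∘ punchIn∘e′)) ⟩
  h x + ∑ (h ∘ punchIn x ∘ e′)   ≤⟨ +-monoʳ-≤ (h x) (∑-injective (h ∘ punchIn x) e′ e′-injective) ⟩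
  h x + ∑ (h ∘ punchIn x)        ≡⟨ sum-remove {i = x} h ⟨
  ∑ h                            ∎
  where
  open ≤-Reasoning
  x = e zero
  misses : ∀ j → e (suc j) ≢ x
  misses j eq with inj eq
  ... | ()
  factored = factor x (e ∘ suc) (suc-injective ∘ inj) misses
  e′ = proj₁ factored
  e′-injective = proj₁ (proj₂ factored)
  punchIn∘e′ = proj₂ (proj₂ factored)

deg-split : ∀ {n} (G : Graph (suc n)) w x →
            deg G w ≡ ⟦ adj G w x ⟧ + ∑ (λ j → ⟦ adj G w (punchIn x j) ⟧)
deg-split G w x = trans (deg-∑ G w) (sum-remove {i = x} (λ j → ⟦ adj G w j ⟧))

deg-others : ∀ {n} (G : Graph (suc n)) i → deg G i ≡ ∑ (λ j → ⟦ adj G i (punchIn i j) ⟧)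
deg-others G i =
  trans (deg-split G i i) (cong (λ b → ⟦ b ⟧ + ∑ (λ j → ⟦ adj G i (punchIn i j) ⟧)) (irrefl G i))

deg-bound : ∀ {n} (G : Graph (suc n)) i → deg G i ≤ n
deg-bound G i =
  ≤-trans (≤-reflexive (deg-others G i)) (∑-≤1 _ (λ j → ⟦⟧≤1 (adj G i (punchIn i j))))

deg-dominating : ∀ {n} (G : Graph (suc n)) v → Dominating G v → deg G v ≡ n
deg-dominating G v dom =
  trans (deg-others G v) (∑-ones _ (λ j → cong ⟦_⟧ (dom (punchIn v j) (punchInᵢ≢i v j))))

deg-delete : ∀ {n} (G : Graph (suc n)) {x w} (x≢w : x ≢ w) →
             deg G w ≡ ⟦ adj G w x ⟧ + deg (delete G x) (punchOut x≢w)
deg-delete G {x} {w} x≢w = begin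
  deg G w                                 ≡⟨ deg-split G w x ⟩
  ⟦ adj G w x ⟧ + rest w               ≡⟨ cong (λ u → ⟦ adj G w x ⟧ + rest u) (punchIn-punchOut x≢w) ⟨
  ⟦ adj G w x ⟧ + rest (punchIn x w′)  ≡⟨ cong (⟦ adj G w x ⟧ +_) (deg-∑ (delete G x) w′) ⟨
  ⟦ adj G w x ⟧ + deg (delete G x) w′  ∎
  where
  open ≡-Reasoning
  w′ = punchOut x≢w
  rest : _ → ℕ
  rest u = ∑ (λ j → ⟦ adj G u (punchIn x j) ⟧)

deg-induce : ∀ {m n} (G : Graph n) (e : Fin m → Fin n) → Injective _≡_ _≡_ e →
             ∀ i → deg (induce G e) i ≤ deg G (e i)
deg-induce G e inj i = begin
  deg (induce G e) i                   ≡⟨ deg-∑ (induce G e) i ⟩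
  ∑ (λ j → ⟦ adj G (e i) (e j) ⟧)      ≤⟨ ∑-injective (λ j → ⟦ adj G (e i) j ⟧) e inj ⟩
  ∑ (λ j → ⟦ adj G (e i) j ⟧)          ≡⟨ deg-∑ G (e i) ⟨
  deg G (e i)                          ∎
  where open ≤-Reasoning

⋁ : ∀ {n} → (Fin n → ℕ) → ℕ
⋁ h = foldr _⊔_ 0 (tabulate h)

maxDeg-⋁ : ∀ {n} (G : Graph n) → maxDeg G ≡ ⋁ (deg G)
maxDeg-⋁ G = cong (foldr _⊔_ 0) (map-tabulate (λ i → i) (deg G))

≤-⋁ : ∀ {n} (h : Fin n → ℕ) i → h i ≤ ⋁ h
≤-⋁ h zero    = m≤m⊔n _ _
≤-⋁ h (suc i) = ≤-trans (≤-⋁ (h ∘ suc) i) (m≤n⊔m _ _)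

⋁-lub : ∀ {n} (h : Fin n → ℕ) {b} → (∀ i → h i ≤ b) → ⋁ h ≤ b
⋁-lub {zero}  h h≤b = z≤n
⋁-lub {suc n} h h≤b = ⊔-lub (h≤b zero) (⋁-lub (h ∘ suc) (h≤b ∘ suc))

⋁-attained : ∀ {n} (h : Fin (suc n) → ℕ) → ∃ λ i → ⋁ h ≡ h i
⋁-attained {zero}  h = zero , ⊔-identityʳ (h zero)
⋁-attained {suc n} h with ⊔-sel (h zero) (⋁ (h ∘ suc))
... | inj₁ left  = zero , left
... | inj₂ right with ⋁-attained (h ∘ suc)
...   | i , max≡ = suc i , trans right max≡

deg≤maxDeg : ∀ {n} (G : Graph n) i → deg G i ≤ maxDeg G
deg≤maxDeg G i = ≤-trans (≤-⋁ (deg G) i) (≤-reflexive (sym (maxDeg-⋁ G)))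

maxDeg-lub : ∀ {n} (G : Graph n) {b} → (∀ i → deg G i ≤ b) → maxDeg G ≤ b
maxDeg-lub G deg≤b = ≤-trans (≤-reflexive (maxDeg-⋁ G)) (⋁-lub (deg G) deg≤b)

maxDeg-attained : ∀ {n} (G : Graph (suc n)) → ∃ λ u → maxDeg G ≡ deg G u
maxDeg-attained G = map₂ (trans (maxDeg-⋁ G)) (⋁-attained (deg G))

maxDeg-bound : ∀ {n} (G : Graph (suc n)) → maxDeg G ≤ n
maxDeg-bound G = maxDeg-lub G (deg-bound G)

maxDeg-dominating : ∀ {n} (G : Graph (suc n)) v → Dominating G v → maxDeg G ≡ n
maxDeg-dominating G v dom =
  ≤-antisym (maxDeg-bound G) (≤-trans (≤-reflexive (sym (deg-dominating G v dom))) (deg≤maxDeg G v))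

maxDeg-induce : ∀ {m n} (G : Graph n) (e : Fin m → Fin n) → Injective _≡_ _≡_ e →
                maxDeg (induce G e) ≤ maxDeg G
maxDeg-induce G e inj =
  maxDeg-lub (induce G e) (λ i → ≤-trans (deg-induce G e inj i) (deg≤maxDeg G (e i)))

maxDeg-non-neighbours : ∀ {m} (K : Graph (suc m)) →
                        (∀ i → ∃ λ j → j ≢ i × adj K i j ≡ false) → maxDeg K < m
maxDeg-non-neighbours {zero} K non-nb with non-nb zero
... | zero , 0≢0 , _ = contradiction refl 0≢0
maxDeg-non-neighbours {suc m} K non-nb = s≤s (maxDeg-lub K deg≤m)
  where
  deg≤m : ∀ i → deg K i ≤ m
  deg≤m i with non-nb i
  ... | j , j≢i , i≁j = begin
    deg K i                  ≡⟨ deg-delete K j≢i ⟩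
    ⟦ adj K i j ⟧ + deg′     ≡⟨ cong (λ b → ⟦ b ⟧ + deg′) i≁j ⟩
    deg′                     ≤⟨ deg-bound (delete K j) (punchOut j≢i) ⟩
    m                        ∎
    where
    open ≤-Reasoning
    deg′ = deg (delete K j) (punchOut j≢i)

Private : ∀ {n c} → (Fin n → Fin c) → Fin n → Set
Private f x = ∀ j → j ≢ x → f j ≢ f x

adjacent⇒≢ : ∀ {n} (G : Graph n) {i j} → adj G i j ≡ true → i ≢ j
adjacent⇒≢ G {i} i~j refl with trans (sym i~j) (irrefl G i)
... | ()

recolour : ∀ {n} {G : Graph n} {d d′} → d ≤ d′ → Colorable G d → Colorable G d′
recolour d≤d′ (f , proper) =
  (λ i → inject≤ (f i) d≤d′) ,
  λ i j i~j eq → proper i j i~j (inject≤-injective d≤d′ d≤d′ _ _ eq)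

restrict : ∀ {m n} {G : Graph n} (e : Fin m → Fin n) {d} → Colorable G d → Colorable (induce G e) d
restrict e (f , proper) = f ∘ e , λ i j → proper (e i) (e j)

colorable-≗ : ∀ {m n} (G : Graph n) {e e′ : Fin m → Fin n} {d} →
              (∀ i → e i ≡ e′ i) → Colorable (induce G e) d → Colorable (induce G e′) d
colorable-≗ G e≗e′ (f , proper) =
  f , λ i j i~j → proper i j (subst₂ (λ a b → adj G a b ≡ true) (sym (e≗e′ i)) (sym (e≗e′ j)) i~j)

colorable-onto : ∀ {m n} (G : Graph n) (e : Fin m → Fin n) {d} →
                 (∀ x → ∃ λ j → e j ≡ x) → Colorable (induce G e) d → Colorable G d
colorable-onto G e onto (f , proper) = f ∘ preimage , proper′
  where
  preimage = proj₁ ∘ onto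
  proper′ : ProperColoring G (f ∘ preimage)
  proper′ u w u~w = proper _ _ (subst₂ (λ a b → adj G a b ≡ true)
                                       (sym (proj₂ (onto u))) (sym (proj₂ (onto w))) u~w)

colorable-self : ∀ {n} (G : Graph n) → Colorable G n
colorable-self G = (λ i → i) , λ i j → adjacent⇒≢ G

uncolorable-0 : ∀ {n} (G : Graph (suc n)) → ¬ Colorable G 0
uncolorable-0 G (f , _) with f zero
... | ()

data DeletionView {n} (x : Fin (suc n)) : Fin (suc n) → Set where
  itself : DeletionView x x
  other  : ∀ j → DeletionView x (punchIn x j)

deletion-view : ∀ {n} (x u : Fin (suc n)) → DeletionView x u
deletion-view x u with u ≟ x
... | yes refl = itself
... | no u≢x   = subst (DeletionView x) (punchIn-punchOut (u≢x ∘ sym)) (other _)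

freshColour : ∀ {n t} → (Fin n → Fin t) → Fin (suc n) → Fin (suc n) → Fin (suc t)
freshColour {t = t} g x = insertAt (inject₁ ∘ g) x (fromℕ t)

module _ {n t} (g : Fin n → Fin t) (x : Fin (suc n)) where

  fresh-at : freshColour g x x ≡ fromℕ t
  fresh-at = insertAt-lookup (inject₁ ∘ g) x (fromℕ t)

  fresh-other : ∀ j → freshColour g x (punchIn x j) ≡ inject₁ (g j)
  fresh-other = insertAt-punchIn (inject₁ ∘ g) x (fromℕ t)

  fresh≢old : ∀ j → freshColour g x (punchIn x j) ≢ freshColour g x x
  fresh≢old j eq = fromℕ≢inject₁ (trans (sym fresh-at) (trans (sym eq) (fresh-other j)))

  old-injective : ∀ i j → freshColour g x (punchIn x i) ≡ freshColour g x (punchIn x j) → g i ≡ g j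
  old-injective i j eq = inject₁-injective (trans (sym (fresh-other i)) (trans eq (fresh-other j)))

  fresh-proper : (G : Graph (suc n)) → ProperColoring (delete G x) g → ProperColoring G (freshColour g x)
  fresh-proper G proper i j i~j with deletion-view x i | deletion-view x j
  ... | itself   | itself   = λ _ → adjacent⇒≢ G i~j refl
  ... | itself   | other j′ = fresh≢old j′ ∘ sym
  ... | other i′ | itself   = fresh≢old i′
  ... | other i′ | other j′ = proper i′ j′ i~j ∘ old-injective i′ j′

  fresh-private : Private (freshColour g x) x
  fresh-private j j≢x with deletion-view x j
  ... | itself   = contradiction refl j≢x
  ... | other j′ = fresh≢old j′

  fresh-keeps-private : ∀ x′ → Private g x′ → Private (freshColour g x) (punchIn x x′)
  fresh-keeps-private x′ x′-private j j≢x′ with deletion-view x j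
  ... | itself   = fresh≢old x′ ∘ sym
  ... | other j′ = x′-private j′ (j≢x′ ∘ cong (punchIn x)) ∘ old-injective j′ x′

add-vertex : ∀ {n} (G : Graph (suc n)) x {t} → Colorable (delete G x) t → Colorable G (suc t)
add-vertex G x (g , proper) = freshColour g x , fresh-proper g x G proper

drop-unused : ∀ {n d} (G : Graph n) (f : Fin n → Fin (suc d)) → ProperColoring G f →
              ∀ a → (∀ i → f i ≢ a) → Colorable G d
drop-unused G f proper a unused = g , λ i j i~j eq → proper i j i~j (punchOut-injective (a≢ i) (a≢ j) eq)
  where
  a≢ : ∀ i → a ≢ f i
  a≢ i = unused i ∘ sym
  g : Fin _ → Fin _
  g i = punchOut (a≢ i)

remove-private : ∀ {n d} (G : Graph (suc n)) (f : Fin (suc n) → Fin (suc d)) →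
                 ProperColoring G f → ∀ w → Private f w → Colorable (delete G w) d
remove-private G f proper w w-private =
  drop-unused (delete G w) (f ∘ punchIn w) (λ i j → proper (punchIn w i) (punchIn w j))
              (f w) (λ j → w-private (punchIn w j) (punchInᵢ≢i w j))

dominating-private : ∀ {n c} (G : Graph n) {f : Fin n → Fin c} w →
                     Dominating G w → ProperColoring G f → Private f w
dominating-private G w dom proper j j≢w fj≡fw = proper w j (dom j j≢w) (sym fj≡fw)

remove-dominating : ∀ {n d} (G : Graph (suc n)) w → Dominating G w →
                    Colorable G (suc d) → Colorable (delete G w) d
remove-dominating G w dom (f , proper) = remove-private G f proper w (dominating-private G w dom proper)

-- Adding back the n - m vertices outside an m-vertex induced subgraph costs
-- at most one new colour per vertex.
extension : ∀ {m n} (G : Graph n) (e : Fin m → Fin n) → Injective _≡_ _≡_ e → ∀ {d} →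
            Colorable (induce G e) d → Colorable G (d + (n ∸ m))
extension {n = zero} G e inj col = (λ ()) , λ ()
extension {m} {suc n} G e inj {d} col = [ grow , fill ]′ (missed-or-onto e)
  where
  fill : (∀ x → ∃ λ j → e j ≡ x) → Colorable G (d + (suc n ∸ m))
  fill onto = recolour {G = G} (m≤m+n d _) (colorable-onto G e onto col)

  grow : (∃ λ x → ∀ j → e j ≢ x) → Colorable G (d + (suc n ∸ m))
  grow (x , misses) = subst (Colorable G) count
    (add-vertex G x (extension {n = n} (delete G x) e′ e′-injective col′))
    where
    factored = factor x e inj misses
    e′ = proj₁ factored
    e′-injective = proj₁ (proj₂ factored)
    col′ : Colorable (induce (delete G x) e′) d
    col′ = colorable-≗ G (sym ∘ proj₂ (proj₂ factored)) col
    count : suc (d + (n ∸ m)) ≡ d + (suc n ∸ m)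
    count = trans (sym (+-suc d (n ∸ m))) (cong (d +_) (sym (+-∸-assoc 1 (injective⇒≤ e′-injective))))

∃-function? : ∀ n c (P : (Fin n → Fin c) → Set) →
              (∀ {f g} → (∀ i → f i ≡ g i) → P f → P g) → (∀ f → Dec (P f)) → Dec (Σ _ P)
∃-function? zero    c P ext P? = map′ (λ p → _ , p) (λ (f , p) → ext (λ ()) p) (P? (λ ()))
∃-function? (suc n) c P ext P? =
  map′ from to (any? (λ a → ∃-function? n c (P ∘ (a ∷_)) ext′ (P? ∘ (a ∷_))))
  where
  from : (∃ λ a → Σ _ (P ∘ (a ∷_))) → Σ _ P
  from (a , g , p) = a ∷ g , p
  to : Σ _ P → ∃ λ a → Σ _ (P ∘ (a ∷_))
  to (f , p) = f zero , f ∘ suc , ext (λ { zero → refl ; (suc i) → refl }) p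
  ext′ : ∀ {a f g} → (∀ i → f i ≡ g i) → P (a ∷ f) → P (a ∷ g)
  ext′ f≗g = ext (λ { zero → refl ; (suc i) → f≗g i })

colorable? : ∀ {n} (G : Graph n) c → Dec (Colorable G c)
colorable? G c = ∃-function? _ c (ProperColoring G) respects proper?
  where
  respects : ∀ {f g} → (∀ i → f i ≡ g i) → ProperColoring G f → ProperColoring G g
  respects f≗g proper i j i~j eq = proper i j i~j (trans (f≗g i) (trans eq (sym (f≗g j))))
  proper? : ∀ f → Dec (ProperColoring G f)
  proper? f = all? λ i → all? λ j → (adj G i j Bool.≟ true) →-dec ¬? (f i ≟ f j)

least : (P : ℕ → Set) → (∀ c → Dec (P c)) → ∀ n → P n →
        ∃ λ c → P c × (∀ c′ → c′ < c → ¬ P c′)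
least P P? n pn =
  [ (λ found → found) , (λ none → contradiction pn (none n (n<1+n n))) ]′ (search (suc n))
  where
  search : ∀ b → (∃ λ c → P c × (∀ c′ → c′ < c → ¬ P c′)) ⊎ (∀ c → c < b → ¬ P c)
  search zero    = inj₂ (λ c ())
  search (suc b) with search b
  ... | inj₁ found = inj₁ found
  ... | inj₂ none with P? b
  ...   | yes pb = inj₁ (b , pb , none)
  ...   | no ¬pb = inj₂ λ c c<1+b → [ none c , (λ { refl → ¬pb }) ]′ (m<1+n⇒m<n∨m≡n c<1+b)

chromatic : ∀ {n} (G : Graph n) → Σ ℕ (IsChromaticNumber G)
chromatic G = least (Colorable G) (colorable? G) _ (colorable-self G)

χ-minimal : ∀ {n} (G : Graph n) {c d} → IsChromaticNumber G c → Colorable G d → c ≤ d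
χ-minimal G (_ , fewer-fail) col = ≮⇒≥ (λ d<c → fewer-fail _ d<c col)

χ-unique : ∀ {n} (G : Graph n) {c c′} → IsChromaticNumber G c → IsChromaticNumber G c′ → c ≡ c′
χ-unique G χ χ′ = ≤-antisym (χ-minimal G χ (proj₁ χ′)) (χ-minimal G χ′ (proj₁ χ))

-- A dominating vertex needs a colour of its own: χ(G) = χ(G - v) + 1.
χ-dominating : ∀ {n} (G : Graph (suc n)) v → Dominating G v →
               ∀ {c} → IsChromaticNumber (delete G v) c → IsChromaticNumber G (suc c)
χ-dominating G v dom (col , fewer-fail) = add-vertex G v col , fewer
  where
  fewer : ∀ c′ → c′ < suc _ → ¬ Colorable G c′
  fewer zero     _     = uncolorable-0 G
  fewer (suc c′) c′<c = fewer-fail c′ (s≤s⁻¹ c′<c) ∘ remove-dominating G v dom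

optimal-no-empty-class : ∀ {n c} (G : Graph n) → IsChromaticNumber G c →
                         ∀ {f : Fin n → Fin c} → ProperColoring G f → ∀ a → ¬ (∀ i → f i ≢ a)
optimal-no-empty-class {c = suc c} G (_ , fewer-fail) {f} proper a unused =
  fewer-fail c (n<1+n c) (drop-unused G f proper a unused)

class-cases : ∀ {n c} (f : Fin n → Fin c) a →
              (∀ i → f i ≢ a) ⊎ (∃ λ x → f x ≡ a × Private f x) ⊎
              (∃ λ i → ∃ λ j → i ≢ j × f i ≡ a × f j ≡ a)
class-cases f a with any? (λ i → f i ≟ a)
... | no none = inj₁ (λ i fi≡a → none (i , fi≡a))
... | yes (x , fx≡a) with any? (λ j → ¬? (j ≟ x) ×-dec (f j ≟ a))
...   | yes (j , j≢x , fj≡a) = inj₂ (inj₂ (x , j , j≢x ∘ sym , fx≡a , fj≡a))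
...   | no none = inj₂ (inj₁ (x , fx≡a , λ j j≢x fj≡fx → none (j , j≢x , trans fj≡fx fx≡a)))

-- Condition (2) of the theorem, restated: no optimal colouring of H leaves
-- a vertex alone in its colour class (empty classes are impossible anyway).
NoPrivateVertex : ∀ {n} → Graph n → Set
NoPrivateVertex {n} H =
  ∀ c → IsChromaticNumber H c → ∀ (f : Fin n → Fin c) → ProperColoring H f → ∀ x → ¬ Private f x

classes⇒no-private : ∀ {n} (H : Graph n) → OptimalClassesAtLeastTwo H → NoPrivateVertex H
classes⇒no-private H classes c χ f proper x x-private with classes c χ f proper (f x)
... | i , j , i≢j , fi≡fx , fj≡fx with i ≟ x
...   | yes refl = x-private j (i≢j ∘ sym) fj≡fx
...   | no i≢x   = x-private i i≢x fi≡fx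

-- Conversely, by class-cases: empty classes are impossible in optimal
-- colourings and singleton classes are excluded by assumption.
no-private⇒classes : ∀ {n} (H : Graph n) → NoPrivateVertex H → OptimalClassesAtLeastTwo H
no-private⇒classes H none c χ f proper a with class-cases f a
... | inj₁ empty                       = contradiction empty (optimal-no-empty-class H χ proper a)
... | inj₂ (inj₁ (x , _ , x-private)) = contradiction x-private (none c χ f proper x)
... | inj₂ (inj₂ two)                  = two

no-private⇒critical : ∀ {n} (H : Graph (suc n)) → NoPrivateVertex H →
                      ∀ {c} → IsChromaticNumber H c → ∀ x {t} → Colorable (delete H x) t → c ≤ t
no-private⇒critical H none {c} χH x {t} (g , proper) with c ≤? t
... | yes c≤t = c≤t
... | no  c≰t = contradiction (fresh-private g x) (none (suc t) χ′ (freshColour g x) proper′ x)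
  where
  proper′ = fresh-proper g x H proper
  χ′ : IsChromaticNumber H (suc t)
  χ′ = subst (IsChromaticNumber H) (≤-antisym (χ-minimal H χH (_ , proper′)) (≰⇒> c≰t)) χH

bound-colorable : ∀ {m k} (H : Graph m) → DegBound k H → ∀ {d} → Colorable H d → maxDeg H + 1 ≤ d + k
bound-colorable {k = k} H bound col with chromatic H
... | c , χ = ≤-trans (bound c χ) (+-monoˡ-≤ k (χ-minimal H χ col))

ProperBound : ∀ {n} → ℕ → Graph n → Set
ProperBound {n} k G =
  ∀ m (e : Fin m → Fin n) → Injective _≡_ _≡_ e → m < n → 0 < m → DegBound k (induce G e)

proper-in-Υ : ∀ {n k} (G : Graph n) → ProperBound k G →
              ∀ m (e : Fin m → Fin n) → Injective _≡_ _≡_ e → m < n → InUpsilon k (induce G e)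
proper-in-Υ G bound m e inj m<n m′ e′ inj′ =
  bound m′ (e ∘ e′) (λ eq → inj′ (inj eq)) (≤-<-trans (injective⇒≤ inj′) m<n)

-- G ∈ Υ_k as soon as the bound holds for G and its proper induced subgraphs:
-- an injective relabelling on ≥ n vertices has Δ ≤ Δ(G) and χ ≥ χ(G).
in-Υ : ∀ {n k} (G : Graph n) → ProperBound k G → DegBound k G → InUpsilon k G
in-Υ {n} G bound boundG m e inj 0<m with m <? n
... | yes m<n = bound m e inj m<n 0<m
... | no  m≮n = λ c χS →
  ≤-trans (+-monoˡ-≤ 1 (maxDeg-induce G e inj))
          (bound-colorable G boundG (subst (Colorable G) (no-extra c) (extension G e inj (proj₁ χS))))
  where
  no-extra : ∀ c → c + (n ∸ m) ≡ c
  no-extra c = trans (cong (c +_) (m≤n⇒m∸n≡0 (≮⇒≥ m≮n))) (+-identityʳ c)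

empty-in-Υ : ∀ {k} (G : Graph 0) → InUpsilon k G
empty-in-Υ G (suc m) e _ _ with e zero
... | ()

forbidden-proper : ∀ {n k} (G : Graph n) → InForbidden k G → ProperBound k G
forbidden-proper G (_ , proper) m e inj m<n 0<m = proper m e inj m<n m (λ i → i) (λ eq → eq) 0<m

forbidden-violates : ∀ {n k} (G : Graph n) → InForbidden k G →
                     ∀ {c} → IsChromaticNumber G c → c + k ≤ maxDeg G
forbidden-violates {k = k} G forbidden {c} χ with maxDeg G + 1 ≤? c + k
... | no  ¬fits = s≤s⁻¹ (≤-trans (≰⇒> ¬fits) (≤-reflexive (+-comm (maxDeg G) 1)))
... | yes fits  = contradiction (in-Υ G (forbidden-proper G forbidden) boundG) (proj₁ forbidden)
  where
  boundG : DegBound k G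
  boundG c′ χ′ = subst (λ c → maxDeg G + 1 ≤ c + k) (χ-unique G χ χ′) fits

Characterised : ∀ {n} → ℕ → Graph n → Set
Characterised {n} k G =
  Σ (Fin n) (λ v → (Dominating G v × (∀ w → Dominating G w → w ≡ v))
                   × OptimalClassesAtLeastTwo (delete G v))
  × DeltaEqChiPlus k G

-- A vertex u of
-- maximum degree satisfies deg(u) ≥ χ(G) + k, while in each G - x it has degree
-- < χ(G - x) + k ≤ χ(G) + k; hence every x is a neighbour of u, and every
-- G - x (x ≠ u) still needs χ(G) colours.  This rules out a second dominating
-- vertex and private vertices in optimal colourings of G - u.
module Necessity {k p} (G : Graph (suc (suc p))) (forbidden : InForbidden k G)
               {cG} (χG : IsChromaticNumber G cG) {u} (Δ≡deg-u : maxDeg G ≡ deg G u)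
               {c} (χH : IsChromaticNumber (delete G u) c) where

  H : Graph (suc p)
  H = delete G u

  violates : cG + k ≤ maxDeg G
  violates = forbidden-violates G forbidden χG

  deletion-bound : ∀ {x} (x≢u : x ≢ u) {t} → Colorable (delete G x) t →
                   deg (delete G x) (punchOut x≢u) < t + k
  deletion-bound {x} x≢u col =
    ≤-trans (≤-reflexive (+-comm 1 _))
      (≤-trans (+-monoˡ-≤ 1 (deg≤maxDeg (delete G x) (punchOut x≢u)))
               (bound-colorable (delete G x) G-x-bound col))
    where
    G-x-bound : DegBound k (delete G x)
    G-x-bound = forbidden-proper G forbidden _ (punchIn x) (λ {i} {j} → punchIn-injective x i j)
                                 (n<1+n _) (s≤s z≤n)

  -- (1a) u is dominating: for a non-neighbour x, deleting x would not lower
  -- deg(u) = Δ(G) ≥ χ(G) + k, yet deg(u) < χ(G) + k in G - x.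
  u-dominating : Dominating G u
  u-dominating x x≢u with adj G u x in u~x
  ... | true  = refl
  ... | false = contradiction (begin-strict
    deg′                    <⟨ deletion-bound x≢u (restrict {G = G} (punchIn x) (proj₁ χG)) ⟩
    cG + k                  ≤⟨ violates ⟩
    maxDeg G                ≡⟨ trans Δ≡deg-u (deg-delete G x≢u) ⟩
    ⟦ adj G u x ⟧ + deg′    ≡⟨ cong (λ b → ⟦ b ⟧ + deg′) u~x ⟩
    deg′                    ∎) (<-irrefl refl)
    where
    open ≤-Reasoning
    deg′ = deg (delete G x) (punchOut x≢u)

  deletion-Δ : ∀ {x} → x ≢ u → ∀ {t} → Colorable (delete G x) t → maxDeg G ≤ t + k
  deletion-Δ {x} x≢u {t} col = begin
    maxDeg G                ≡⟨ trans Δ≡deg-u (deg-delete G x≢u) ⟩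
    ⟦ adj G u x ⟧ + deg′    ≡⟨ cong (λ b → ⟦ b ⟧ + deg′) (u-dominating x x≢u) ⟩
    suc deg′                ≤⟨ deletion-bound x≢u col ⟩
    t + k                   ∎
    where
    open ≤-Reasoning
    deg′ = deg (delete G x) (punchOut x≢u)

  critical : ∀ x → x ≢ u → ∀ {t} → Colorable (delete G x) t → cG ≤ t
  critical x x≢u {t} col = +-cancelʳ-≤ k cG t (≤-trans violates (deletion-Δ x≢u col))

  -- (3) Δ(G) = χ(G) + k, using G - x₀ for any vertex x₀ ≠ u.
  Δ≡χ+k : maxDeg G ≡ cG + k
  Δ≡χ+k = ≤-antisym (deletion-Δ x₀≢u (restrict {G = G} (punchIn x₀) (proj₁ χG))) violates
    where
    x₀ = punchIn u zero
    x₀≢u = punchInᵢ≢i u zero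

  cG≡1+c : cG ≡ suc c
  cG≡1+c = χ-unique G χG (χ-dominating G u u-dominating χH)

  no-cheap-deletion : ∀ x → x ≢ u → ¬ Colorable (delete G x) c
  no-cheap-deletion x x≢u col = <-irrefl refl (subst (_≤ c) cG≡1+c (critical x x≢u col))

  -- (1b) u is the only dominating vertex: deleting another one would save a colour.
  u-unique : ∀ w → Dominating G w → w ≡ u
  u-unique w w-dominating with w ≟ u
  ... | yes w≡u = w≡u
  ... | no  w≢u = contradiction
    (remove-dominating G w w-dominating (subst (Colorable G) cG≡1+c (proj₁ χG)))
    (no-cheap-deletion w w≢u)

  -- (2) If x′ were alone in its class of an optimal colouring of H, colouring u
  -- freshly would leave x′ alone as well, and G - x′ would need only χ(H) colours.
  H-no-private : NoPrivateVertex H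
  H-no-private c′ χ′ f proper x′ x′-private =
    no-cheap-deletion x (punchInᵢ≢i u x′) (subst (Colorable (delete G x)) (χ-unique H χ′ χH) col)
    where
    x = punchIn u x′
    col : Colorable (delete G x) c′
    col = remove-private G (freshColour f u) (fresh-proper f u G proper) x
                         (fresh-keeps-private f u x′ x′-private)

  characterised : Characterised k G
  characterised = (u , (u-dominating , u-unique) , no-private⇒classes H H-no-private) ,
                  λ c′ χ′ → trans Δ≡χ+k (cong (_+ k) (χ-unique G χG χ′))

forbidden⇒characterised : ∀ {k n} (G : Graph n) → InForbidden k G → Characterised k G
forbidden⇒characterised {n = zero} G forbidden = contradiction (empty-in-Υ G) (proj₁ forbidden)
forbidden⇒characterised {n = suc zero} G forbidden with chromatic G
... | zero  , χ = contradiction (proj₁ χ) (uncolorable-0 G)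
... | suc c , χ = contradiction (≤-trans (forbidden-violates G forbidden χ) (maxDeg-bound G)) λ ()
forbidden⇒characterised {n = suc (suc p)} G forbidden with chromatic G | maxDeg-attained G
... | cG , χG | u , Δ≡deg-u =
  Necessity.characterised G forbidden χG Δ≡deg-u (proj₂ (chromatic (delete G u)))

non-neighbour : ∀ {n} (G : Graph n) u → ¬ Dominating G u → ∃ λ w → w ≢ u × adj G u w ≡ false
non-neighbour {n} G u ¬dominating with ¬∀⟶∃¬ n _ neighbour? ¬dominating
  where
  neighbour? : ∀ w → Dec (w ≢ u → adj G u w ≡ true)
  neighbour? w = ¬? (w ≟ u) →-dec (adj G u w Bool.≟ true)
... | w , ¬neighbour = w , (λ w≡u → ¬neighbour (λ w≢u → contradiction w≡u w≢u)) ,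
                       ¬-not (λ u~w → ¬neighbour (λ _ → u~w))

-- For a dominating v, Δ(G) = |G| - 1 and χ(G) = χ(G - v) + 1, so (3) fixes |G|.
dominated-order : ∀ {k n} (G : Graph (suc n)) v → Dominating G v → DeltaEqChiPlus k G →
                  ∀ {c} → IsChromaticNumber (delete G v) c → n ≡ suc (c + k)
dominated-order G v dominating Δ≡χ+k χH =
  trans (sym (maxDeg-dominating G v dominating)) (Δ≡χ+k _ (χ-dominating G v dominating χH))

-- If deleting any vertex of H leaves χ(H) = c unchanged, then every m-vertex
-- induced subgraph missing some vertex and colourable with d colours has
-- c + m ≤ d + (|H| - 1): extend its colouring to H - x one vertex at a time.
critical-subgraph : ∀ {N} (H : Graph (suc N)) {c} → (∀ x {t} → Colorable (delete H x) t → c ≤ t) →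
                    ∀ {m} (e : Fin m → Fin (suc N)) → Injective _≡_ _≡_ e →
                    ∀ {x} → (∀ j → e j ≢ x) → ∀ {d} → Colorable (induce H e) d → c + m ≤ d + N
critical-subgraph {N} H {c} critical {m} e inj {x} misses {d} col = begin
  c + m              ≤⟨ +-monoˡ-≤ m (critical x (extension (delete H x) e′ e′-injective col′)) ⟩
  d + (N ∸ m) + m    ≡⟨ +-assoc d (N ∸ m) m ⟩
  d + (N ∸ m + m)    ≡⟨ cong (d +_) (m∸n+n≡m (injective⇒≤ e′-injective)) ⟩
  d + N              ∎
  where
  open ≤-Reasoning
  factored = factor x e inj misses
  e′ = proj₁ factored
  e′-injective = proj₁ (proj₂ factored)
  col′ : Colorable (induce (delete H x) e′) d
  col′ = colorable-≗ H (sym ∘ proj₂ (proj₂ factored)) col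

-- Sufficiency, for G with at least two vertices, unique dominating vertex v,
-- H = G - v with χ(H) = c and no private vertices in optimal colourings, and
-- |G| = c + k + 2.  H is critical, so a nonempty proper induced subgraph S of G
-- either misses a vertex of H (after removing v if v ∈ S), which bounds its
-- size by χ(S) + k, or is H itself, where uniqueness of v gives every vertex
-- a non-neighbour.
module Sufficiency {k p} (G : Graph (suc (suc p))) {v} (v-dominating : Dominating G v)
                (v-unique : ∀ w → Dominating G w → w ≡ v)
                {c} (χH : IsChromaticNumber (delete G v) c) (no-private : NoPrivateVertex (delete G v))
                (order : p ≡ c + k) where

  H : Graph (suc p)
  H = delete G v

  small : ∀ {m} (e : Fin m → Fin (suc p)) → Injective _≡_ _≡_ e →
          ∀ {x} → (∀ j → e j ≢ x) → ∀ {d} → Colorable (induce H e) d → m ≤ d + k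
  small {m} e inj misses {d} col = +-cancelˡ-≤ c m (d + k) (begin
    c + m         ≤⟨ critical-subgraph H (no-private⇒critical H no-private χH) e inj misses col ⟩
    d + p         ≡⟨ cong (d +_) order ⟩
    d + (c + k)   ≡⟨ x∙yz≈y∙xz d c k ⟩
    c + (d + k)   ∎)
    where open ≤-Reasoning

  -- S ∋ v = E j₀: v dominates S, so S - j₀ needs one colour less than S, and
  -- S - j₀ is an induced subgraph of H on m′ < |H| vertices.
  contains-v : ∀ {m′} (E : Fin (suc m′) → Fin (suc (suc p))) → Injective _≡_ _≡_ E → m′ < suc p →
               ∀ j₀ → E j₀ ≡ v → ∀ {d} → Colorable (induce G E) d → maxDeg (induce G E) < d + k
  contains-v E inj m′<n j₀ Ej₀≡v {zero}  col = contradiction col (uncolorable-0 (induce G E))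
  contains-v E inj m′<n j₀ Ej₀≡v {suc d} col =
    s≤s (≤-trans (maxDeg-bound (induce G E)) (small e′ e′-injective (proj₂ (missed-point e′ m′<n)) col′))
    where
    j₀-dominating : Dominating (induce G E) j₀
    j₀-dominating i i≢j₀ = subst (λ a → adj G a (E i) ≡ true) (sym Ej₀≡v)
                             (v-dominating (E i) (λ Ei≡v → i≢j₀ (inj (trans Ei≡v (sym Ej₀≡v)))))
    avoids-v : ∀ j → E (punchIn j₀ j) ≢ v
    avoids-v j eq = punchInᵢ≢i j₀ j (inj (trans eq (sym Ej₀≡v)))
    factored = factor v (E ∘ punchIn j₀) (λ eq → punchIn-injective j₀ _ _ (inj eq)) avoids-v
    e′ = proj₁ factored
    e′-injective = proj₁ (proj₂ factored)
    col′ : Colorable (induce H e′) d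
    col′ = colorable-≗ G (sym ∘ proj₂ (proj₂ factored))
                         (remove-dominating (induce G E) j₀ j₀-dominating col)

  avoids-v : ∀ {m′} (E : Fin (suc m′) → Fin (suc (suc p))) → Injective _≡_ _≡_ E →
             (∀ j → E j ≢ v) → ∀ {d} → Colorable (induce G E) d → maxDeg (induce G E) < d + k
  avoids-v {m′} E inj avoids {d} col = [ misses-some , covers ]′ (missed-or-onto E′)
    where
    S = induce G E
    factored = factor v E inj avoids
    E′ = proj₁ factored
    E′-injective = proj₁ (proj₂ factored)
    v∘E′ : ∀ j → punchIn v (E′ j) ≡ E j
    v∘E′ = proj₂ (proj₂ factored)
    col′ : Colorable (induce H E′) d
    col′ = colorable-≗ G (sym ∘ v∘E′) col

    misses-some : (∃ λ x → ∀ j → E′ j ≢ x) → maxDeg S < d + k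
    misses-some (x , misses) = ≤-<-trans (maxDeg-bound S) (small E′ E′-injective misses col′)

    -- S = H: then χ(H) ≤ d, and each E i, not being dominating, has a
    -- non-neighbour w, which is not v and hence lies in S.
    covers : (∀ y → ∃ λ j → E′ j ≡ y) → maxDeg S < d + k
    covers onto = <-≤-trans (maxDeg-non-neighbours S non-neighbour-in-S) m′≤d+k
      where
      m′≤c+k : m′ ≤ c + k
      m′≤c+k = s≤s⁻¹ (subst (suc m′ ≤_) (cong suc order) (injective⇒≤ E′-injective))
      m′≤d+k : m′ ≤ d + k
      m′≤d+k = ≤-trans m′≤c+k (+-monoˡ-≤ k (χ-minimal H χH (colorable-onto H E′ onto col′)))
      non-neighbour-in-S : ∀ i → ∃ λ j → j ≢ i × adj S i j ≡ false
      non-neighbour-in-S i with non-neighbour G (E i) (avoids i ∘ v-unique (E i))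
      ... | w , w≢Ei , Ei≁w = j , (λ j≡i → w≢Ei (trans (sym Ej≡w) (cong E j≡i))) ,
                               trans (cong (adj G (E i)) Ej≡w) Ei≁w
        where
        v≢w : v ≢ w
        v≢w v≡w with trans (sym Ei≁w) (trans (cong (adj G (E i)) (sym v≡w))
                           (trans (adj-sym G (E i) v) (v-dominating (E i) (avoids i))))
        ... | ()
        j = proj₁ (onto (punchOut v≢w))
        Ej≡w : E j ≡ w
        Ej≡w = trans (sym (v∘E′ j)) (trans (cong (punchIn v) (proj₂ (onto (punchOut v≢w))))
                                           (punchIn-punchOut v≢w))

  χG : IsChromaticNumber G (suc c)
  χG = χ-dominating G v v-dominating χH

  -- G itself violates the bound: Δ(G) = |G| - 1 = χ(G) + k.
  G∉Υ : ¬ InUpsilon k G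
  G∉Υ Υ = m+1+n≰m (suc (c + k)) (subst (λ Δ → Δ + 1 ≤ suc c + k) Δ≡ G-bound)
    where
    G-bound : maxDeg G + 1 ≤ suc c + k
    G-bound = Υ _ (λ i → i) (λ eq → eq) (s≤s z≤n) (suc c) χG
    Δ≡ : maxDeg G ≡ suc (c + k)
    Δ≡ = trans (maxDeg-dominating G v v-dominating) (cong suc order)

  proper-bound : ProperBound k G
  proper-bound (suc m′) E inj m<n _ d χS =
    ≤-trans (≤-reflexive (+-comm (maxDeg (induce G E)) 1)) (by-cases (any? (λ j → E j ≟ v)))
    where
    by-cases : Dec (∃ λ j → E j ≡ v) → maxDeg (induce G E) < d + k
    by-cases (yes (j₀ , Ej₀≡v)) = contains-v E inj (s≤s⁻¹ m<n) j₀ Ej₀≡v (proj₁ χS)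
    by-cases (no v∉S)           = avoids-v E inj (λ j Ej≡v → v∉S (j , Ej≡v)) (proj₁ χS)

  forbidden : InForbidden k G
  forbidden = G∉Υ , proper-in-Υ G proper-bound

characterised⇒forbidden : ∀ {k n} (G : Graph n) → Characterised k G → InForbidden k G
characterised⇒forbidden {n = zero} G ((() , _) , _)
characterised⇒forbidden {n = suc zero} G ((v , (v-dominating , _) , _) , Δ≡χ+k)
  with chromatic (delete G v)
... | c , χH with dominated-order G v v-dominating Δ≡χ+k χH
...   | ()
characterised⇒forbidden {n = suc (suc p)} G ((v , (v-dominating , v-unique) , classes) , Δ≡χ+k)
  with chromatic (delete G v)
... | c , χH = Sufficiency.forbidden G v-dominating v-unique χH (classes⇒no-private (delete G v) classes)
                 (1+-injective (dominated-order G v v-dominating Δ≡χ+k χH))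

theorem2 : (k n : ℕ) (G : Graph n) →
    InForbidden k G ⇔
      (Σ (Fin n) (λ v →
          (Dominating G v × (∀ w → Dominating G w → w ≡ v))
          × OptimalClassesAtLeastTwo (delete G v))
       × DeltaEqChiPlus k G)
theorem2 k n G = mk⇔ (forbidden⇒characterised G) (characterised⇒forbidden G)
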